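{- Let $p$ be an odd prime and $\mathbf{C}^{(p)}=(c_i)_{i\ge0}$ the $p$-Cantor sequence. For every positive integer $n$, every $0\le j\le p-1$ and every $0\le i\le p^{n-1}-1$, \[c_{jp^{n-1}+i}=\binom{p_2}{j/2}\,c_i \quad\text{in } \mathbb{F}_p;\] that is, the first $p^n$ terms of $\mathbf{C}^{(p)}$ are the concatenation over $j=0,\dots,p-1$ of $\binom{p_2}{j/2}$ times the first $p^{n-1}$ terms.
   Context: $p_2=(p-1)/2$. For real $a,b$, $\binom{a}{b}=\frac{a!}{b!(a-b)!}$ if $a,b$ are nonnegative integers with $a\ge b$, and $0$ otherwise (so $\binom{p_2}{j/2}=0$ for odd $j$). The $p$-Cantor sequence: let $\phi_p$ be the substitution on $\{0,1,\dots,p-1\}$ (identified with $\mathbb{F}_p$) sending each letter $n$ to the length-$p$ word whose $i$-th letter ($0\le i\le p-1$) is $n\binom{p_2}{i/2}\bmod p$, extended to words by concatenation; $\mathbf{C}^{(p)}=(c_i)_{i\ge0}=\lim_{k\to\infty}\phi_p^k(1)$. -}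

module Defs where

open import Data.Nat using (ℕ; zero; suc; _+_; _*_; _^_; _%_; _/_; NonZero)
open import Data.Nat.Combinatorics using (_C_)
open import Data.Bool using (if_then_else_)
open import Data.Nat.Base using (_≡ᵇ_)
open import Data.List using (List; []; _∷_; concatMap; map; upTo)

half : ℕ → ℕ
half p = (p Data.Nat.∸ 1) / 2

-- binom a (j/2) as in the paper: 0 if j is odd, otherwise the binomial
-- coefficient a C (j/2) (which is 0 when j/2 > a).
binomHalf : ℕ → ℕ → ℕ
binomHalf a j = if (j % 2) ≡ᵇ 0 then a C (j / 2) else 0

-- Letters of F_p represented by naturals 0..p-1; the substitution φ_p on a
-- letter n: the word of length p whose i-th letter is n * binom(p₂, i/2) mod p.
φ-letter : (p : ℕ) → .{{NonZero p}} → ℕ → List ℕ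
φ-letter p n = map (λ i → (n * binomHalf (half p) i) % p) (upTo p)

φ : (p : ℕ) → .{{NonZero p}} → List ℕ → List ℕ
φ p = concatMap (φ-letter p)

φ-iter : (p : ℕ) → .{{NonZero p}} → ℕ → List ℕ
φ-iter p zero    = 1 ∷ []
φ-iter p (suc k) = φ p (φ-iter p k)

-- i-th letter of a word (0 if out of range; never used out of range below)
nth : List ℕ → ℕ → ℕ
nth []       _       = 0
nth (x ∷ xs) zero    = x
nth (x ∷ xs) (suc i) = nth xs i

-- The p-Cantor sequence: c_i is the i-th letter of φ_p^k(1) for any k with
-- p^k > i; since φ_p(1) begins with 1 (binom(p₂,0)=1), φ_p^k(1) is a prefix of
-- φ_p^{k+1}(1), and k = i suffices (p^i > i for p ≥ 2).
cantor : (p : ℕ) → .{{NonZero p}} → ℕ → ℕ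
cantor p i = nth (φ-iter p (suc i)) i

-- The word φ_p^k(1) has length p^k, and the letter at position a·p + r of φ_p(u) is
-- u_a · binom(p₂, r/2).  So splitting a position j·p^n + i of φ_p^{n+1}(1) into its last
-- base-p digit and the rest lets the factor binom(p₂, j/2) be carried through an
-- induction on n.  Since φ_p(1) starts with 1, each φ_p^k(1) is a prefix of the next, so
-- the Cantor sequence can be read off any iterate long enough.
module Submission where

open import Defs
open import Data.Nat using (ℕ; suc; _+_; _*_; _^_; _%_; _<_; _≤_; NonZero)
open import Data.Nat.Primality using (Prime)
open import Relation.Binary.PropositionalEquality using (_≡_)

open import Data.Nat.Base using (zero; _∸_; _/_; z≤n; s≤s; nonTrivial⇒n>1)
open import Data.Nat.Properties
open import Data.Nat.DivMod
open import Data.Nat.Primality using (prime⇒nonTrivial)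
open import Data.Nat.Solver using (module +-*-Solver)
open import Data.List using (List; []; _∷_; _++_; length; map; upTo; applyUpTo; concatMap)
open import Data.List.Properties using (length-map; length-upTo; length-++; concatMap-++)
open import Data.Product using (∃; _,_)
open import Data.Sum using (inj₁; inj₂)
open import Relation.Binary.PropositionalEquality
  using (refl; sym; trans; cong; cong₂; subst; module ≡-Reasoning)

nth-map : ∀ (f : ℕ → ℕ) xs {r} → r < length xs → nth (map f xs) r ≡ f (nth xs r)
nth-map f (x ∷ xs) {zero}  _         = refl
nth-map f (x ∷ xs) {suc r} (s≤s r<n) = nth-map f xs r<n

nth-applyUpTo : ∀ (f : ℕ → ℕ) n {r} → r < n → nth (applyUpTo f n) r ≡ f r
nth-applyUpTo f (suc n) {zero}  _         = refl
nth-applyUpTo f (suc n) {suc r} (s≤s r<n) = nth-applyUpTo (λ k → f (suc k)) n r<n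

nth-++ˡ : ∀ u t {m} → m < length u → nth (u ++ t) m ≡ nth u m
nth-++ˡ (x ∷ u) t {zero}  _         = refl
nth-++ˡ (x ∷ u) t {suc m} (s≤s m<u) = nth-++ˡ u t m<u

nth-++ʳ : ∀ u t m → nth (u ++ t) (length u + m) ≡ nth t m
nth-++ʳ []      t m = refl
nth-++ʳ (x ∷ u) t m = nth-++ʳ u t m

map-upTo-head : ∀ (f : ℕ → ℕ) {n} → 0 < n → ∃ λ t → map f (upTo n) ≡ f 0 ∷ t
map-upTo-head f {suc n} _ = _ , refl

module _ {f : ℕ → List ℕ} {m : ℕ} (length-f : ∀ x → length (f x) ≡ m) where

  length-concatMap-const : ∀ u → length (concatMap f u) ≡ m * length u
  length-concatMap-const []      = sym (*-zeroʳ m)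
  length-concatMap-const (x ∷ u) = begin
    length (f x ++ concatMap f u)         ≡⟨ length-++ (f x) ⟩
    length (f x) + length (concatMap f u) ≡⟨ cong₂ _+_ (length-f x) (length-concatMap-const u) ⟩
    m + m * length u                      ≡⟨ *-suc m (length u) ⟨
    m * suc (length u)                    ∎
    where open ≡-Reasoning

  nth-concatMap-const : ∀ u {a r} → a < length u → r < m →
                        nth (concatMap f u) (a * m + r) ≡ nth (f (nth u a)) r
  nth-concatMap-const (x ∷ u) {zero} _ r<m =
    nth-++ˡ (f x) (concatMap f u) (subst (_ <_) (sym (length-f x)) r<m)
  nth-concatMap-const (x ∷ u) {suc a} {r} (s≤s a<u) r<m = begin
    nth (f x ++ concatMap f u) (m + a * m + r)            ≡⟨ cong (nth (f x ++ concatMap f u)) shift ⟩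
    nth (f x ++ concatMap f u) (length (f x) + (a * m + r)) ≡⟨ nth-++ʳ (f x) (concatMap f u) (a * m + r) ⟩
    nth (concatMap f u) (a * m + r)                       ≡⟨ nth-concatMap-const u a<u r<m ⟩
    nth (f (nth u a)) r                                   ∎
    where
    open ≡-Reasoning
    shift : m + a * m + r ≡ length (f x) + (a * m + r)
    shift = trans (+-assoc m (a * m) r) (cong (_+ (a * m + r)) (sym (length-f x)))

[m%d]*n%d≡m*n%d : ∀ m n d .{{_ : NonZero d}} → ((m % d) * n) % d ≡ (m * n) % d
[m%d]*n%d≡m*n%d m n d = begin
  ((m % d) * n) % d             ≡⟨ %-distribˡ-* (m % d) n d ⟩
  ((m % d % d) * (n % d)) % d   ≡⟨ cong (λ k → (k * (n % d)) % d) (m%n%n≡m%n m d) ⟩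
  ((m % d) * (n % d)) % d       ≡⟨ %-distribˡ-* m n d ⟨
  (m * n) % d                   ∎
  where open ≡-Reasoning

m*[n%d]%d≡m*n%d : ∀ m n d .{{_ : NonZero d}} → (m * (n % d)) % d ≡ (m * n) % d
m*[n%d]%d≡m*n%d m n d = begin
  (m * (n % d)) % d ≡⟨ cong (_% d) (*-comm m (n % d)) ⟩
  ((n % d) * m) % d ≡⟨ [m%d]*n%d≡m*n%d n m d ⟩
  (n * m) % d       ≡⟨ cong (_% d) (*-comm n m) ⟩
  (m * n) % d       ∎
  where open ≡-Reasoning

n<m^n : ∀ {m} → 1 < m → ∀ n → n < m ^ n
n<m^n 1<m zero    = s≤s z≤n
n<m^n {m@(suc _)} 1<m (suc n) = begin-strict
  suc n     ≤⟨ n<m^n 1<m n ⟩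
  m ^ n     <⟨ m<m*n (m ^ n) m {{m^n≢0 m n}} 1<m ⟩
  m ^ n * m ≡⟨ *-comm (m ^ n) m ⟩
  m * m ^ n ∎
  where open ≤-Reasoning

m<n⇒o<q⇒m*q+o<n*q : ∀ {m n o q} → m < n → o < q → m * q + o < n * q
m<n⇒o<q⇒m*q+o<n*q {m} {n} {o} {q} m<n o<q = begin-strict
  m * q + o <⟨ +-monoʳ-< (m * q) o<q ⟩
  m * q + q ≡⟨ +-comm (m * q) q ⟩
  suc m * q ≤⟨ *-monoˡ-≤ q m<n ⟩
  n * q     ∎
  where open ≤-Reasoning

module _ (p : ℕ) .{{_ : NonZero p}} (1<p : 1 < p) where

  private
    b : ℕ → ℕ
    b = binomHalf (half p)

    w : ℕ → List ℕ
    w = φ-iter p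

  length-φ-letter : ∀ x → length (φ-letter p x) ≡ p
  length-φ-letter x = trans (length-map _ (upTo p)) (length-upTo p)

  length-φ-iter : ∀ k → length (w k) ≡ p ^ k
  length-φ-iter zero    = refl
  length-φ-iter (suc k) =
    trans (length-concatMap-const length-φ-letter (w k)) (cong (p *_) (length-φ-iter k))

  nth-φ-letter : ∀ x {r} → r < p → nth (φ-letter p x) r ≡ (x * b r) % p
  nth-φ-letter x r<p =
    trans (nth-map _ (upTo p) (subst (_ <_) (sym (length-upTo p)) r<p))
          (cong (λ i → (x * b i) % p) (nth-applyUpTo (λ i → i) p r<p))

  nth-φ : ∀ u {a r} → a < length u → r < p → nth (φ p u) (a * p + r) ≡ (nth u a * b r) % p
  nth-φ u a<u r<p = trans (nth-concatMap-const length-φ-letter u a<u r<p) (nth-φ-letter (nth u _) r<p)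

  φ-iter-prefix : ∀ k → ∃ λ t → w (suc k) ≡ w k ++ t
  φ-iter-prefix zero with map-upTo-head (λ i → (1 * b i) % p) (<-trans (s≤s z≤n) 1<p)
  ... | t , w[1]≡b₀∷t = t ++ [] , trans (cong (_++ []) w[1]≡b₀∷t) (cong (λ x → x ∷ t ++ []) (m<n⇒m%n≡m 1<p))
  φ-iter-prefix (suc k) with φ-iter-prefix k
  ... | t , w[1+k]≡w[k]++t = φ p t , trans (cong (φ p) w[1+k]≡w[k]++t) (concatMap-++ (φ-letter p) (w k) t)

  nth-φ-iter-+ : ∀ d k {m} → m < p ^ k → nth (w (d + k)) m ≡ nth (w k) m
  nth-φ-iter-+ zero    k m<pᵏ = refl
  nth-φ-iter-+ (suc d) k {m} m<pᵏ with φ-iter-prefix (d + k)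
  ... | t , w[1+d+k]≡w[d+k]++t = begin
    nth (w (suc d + k)) m    ≡⟨ cong (λ u → nth u m) w[1+d+k]≡w[d+k]++t ⟩
    nth (w (d + k) ++ t) m   ≡⟨ nth-++ˡ (w (d + k)) t (subst (m <_) (sym (length-φ-iter (d + k))) m<pᵈ⁺ᵏ) ⟩
    nth (w (d + k)) m        ≡⟨ nth-φ-iter-+ d k m<pᵏ ⟩
    nth (w k) m              ∎
    where
    open ≡-Reasoning
    m<pᵈ⁺ᵏ : m < p ^ (d + k)
    m<pᵈ⁺ᵏ = <-≤-trans m<pᵏ (^-monoʳ-≤ p (m≤n+m k d))

  nth-φ-iter-mono : ∀ {k k' m} → k ≤ k' → m < p ^ k → nth (w k') m ≡ nth (w k) m
  nth-φ-iter-mono {k} {k'} {m} k≤k' m<pᵏ =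
    subst (λ l → nth (w l) m ≡ nth (w k) m) (m∸n+n≡m k≤k') (nth-φ-iter-+ (k' ∸ k) k m<pᵏ)

  cantor≡nth-φ-iter : ∀ k {i} → i < p ^ k → cantor p i ≡ nth (w k) i
  cantor≡nth-φ-iter k {i} i<pᵏ with ≤-total k (suc i)
  ... | inj₁ k≤1+i = nth-φ-iter-mono k≤1+i i<pᵏ
  ... | inj₂ 1+i≤k = sym (nth-φ-iter-mono 1+i≤k (<-trans (n<m^n 1<p i) (^-monoʳ-< p 1<p (n<1+n i))))

  nth-φ-iter-block : ∀ n {j i} → j < p → i < p ^ n →
                     nth (w (suc n)) (j * p ^ n + i) ≡ (b j * nth (w n) i) % p
  nth-φ-iter-block zero {j} {zero} j<p _ = begin
    nth (w 1) (j * 1 + 0)          ≡⟨ cong (nth (w 1)) (trans (+-identityʳ (j * 1)) (*-identityʳ j)) ⟩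
    nth (φ p (1 ∷ [])) (0 * p + j) ≡⟨ nth-φ (1 ∷ []) (s≤s z≤n) j<p ⟩
    (1 * b j) % p                  ≡⟨ cong (_% p) (trans (*-identityˡ (b j)) (sym (*-identityʳ (b j)))) ⟩
    (b j * 1) % p                  ∎
    where open ≡-Reasoning
  nth-φ-iter-block zero {i = suc i} _ (s≤s ())
  nth-φ-iter-block (suc n) {j} {i} j<p i<p¹⁺ⁿ = begin
    nth (w (2 + n)) (j * p ^ suc n + i)          ≡⟨ cong (nth (w (2 + n))) digits ⟩
    nth (w (2 + n)) ((j * p ^ n + a) * p + r)    ≡⟨ nth-φ (w (suc n)) (length-φ-iter-< (suc n) (m<n⇒o<q⇒m*q+o<n*q j<p a<pⁿ)) r<p ⟩
    (nth (w (suc n)) (j * p ^ n + a) * b r) % p  ≡⟨ cong (λ c → (c * b r) % p) (nth-φ-iter-block n j<p a<pⁿ) ⟩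
    (((b j * nth (w n) a) % p) * b r) % p        ≡⟨ [m%d]*n%d≡m*n%d (b j * nth (w n) a) (b r) p ⟩
    (b j * nth (w n) a * b r) % p                ≡⟨ cong (_% p) (*-assoc (b j) (nth (w n) a) (b r)) ⟩
    (b j * (nth (w n) a * b r)) % p              ≡⟨ m*[n%d]%d≡m*n%d (b j) (nth (w n) a * b r) p ⟨
    (b j * ((nth (w n) a * b r) % p)) % p        ≡⟨ cong (λ c → (b j * c) % p) (nth-φ (w n) (length-φ-iter-< n a<pⁿ) r<p) ⟨
    (b j * nth (w (suc n)) (a * p + r)) % p      ≡⟨ cong (λ c → (b j * nth (w (suc n)) c) % p) i≡a*p+r ⟨
    (b j * nth (w (suc n)) i) % p                ∎
    where
    open ≡-Reasoning
    open +-*-Solver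
    a = i / p
    r = i % p
    r<p : r < p
    r<p = m%n<n i p
    a<pⁿ : a < p ^ n
    a<pⁿ = m<n*o⇒m/o<n (subst (i <_) (*-comm p (p ^ n)) i<p¹⁺ⁿ)
    i≡a*p+r : i ≡ a * p + r
    i≡a*p+r = trans (m≡m%n+[m/n]*n i p) (+-comm r (a * p))
    length-φ-iter-< : ∀ k {m} → m < p ^ k → m < length (w k)
    length-φ-iter-< k = subst (_ <_) (sym (length-φ-iter k))
    digits : j * p ^ suc n + i ≡ (j * p ^ n + a) * p + r
    digits = trans (cong (j * p ^ suc n +_) i≡a*p+r)
      (solve 5 (λ J P Q A R → J :* (P :* Q) :+ (A :* P :+ R) := (J :* Q :+ A) :* P :+ R)
             refl j p (p ^ n) a r)

lemma3p5 : (p : ℕ) → .{{_ : NonZero p}} → Prime p → p % 2 ≡ 1 →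
    (n : ℕ) → (j : ℕ) → j < p → (i : ℕ) → i < p ^ n →
    cantor p (j * p ^ n + i) ≡ (binomHalf (half p) j * cantor p i) % p
lemma3p5 p p-prime _ n j j<p i i<pⁿ = begin
  cantor p (j * p ^ n + i)                         ≡⟨ cantor≡nth-φ-iter p 1<p (suc n) (m<n⇒o<q⇒m*q+o<n*q j<p i<pⁿ) ⟩
  nth (φ-iter p (suc n)) (j * p ^ n + i)           ≡⟨ nth-φ-iter-block p 1<p n j<p i<pⁿ ⟩
  (binomHalf (half p) j * nth (φ-iter p n) i) % p  ≡⟨ cong (λ c → (binomHalf (half p) j * c) % p) (cantor≡nth-φ-iter p 1<p n i<pⁿ) ⟨
  (binomHalf (half p) j * cantor p i) % p          ∎
  where
  open ≡-Reasoning
  1<p : 1 < p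
  1<p = nonTrivial⇒n>1 p {{prime⇒nonTrivial p-prime}}
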